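{- Let $G$ be a finite simple graph with minimum degree $\delta(G)\ge 2$ such that either $g(G)=6$ or $g(G)\ge 8$. Then $G\notin\Omega$.
   Context: The girth $g(G)$ of a graph that is not a forest is the length of a shortest cycle; a forest has infinite girth. A star is a graph isomorphic to $K_{1,n}$ for some $n\ge 1$. A star-factor of $G$ is a spanning subgraph each of whose connected components is a star. An edge-weighting of $G$ is a function $w:E(G)\to\mathbb{N}^+$ (positive integers), and the weight of a subgraph $H$ is $w(H)=\sum_{e\in E(H)}w(e)$. $\Omega$ denotes the family of all graphs $G$ for which there exists an edge-weighting $w$ of $G$ such that all star-factors of $G$ have the same weight under $w$. -}

module Defs where

open import Data.Nat using (ℕ; zero; suc; _+_; _≤_; _<_; _<ᵇ_; NonZero)
open import Data.Nat.DivMod using (_%_; m%n<n)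
open import Data.Fin using (Fin; toℕ; fromℕ<)
open import Data.List using (List; map; allFin)
open import Data.Nat.ListAction using (sum)
open import Data.Bool using (Bool; true; false; if_then_else_; _∧_)
open import Data.Product using (Σ; ∃; _×_; _,_)
open import Data.Sum using (_⊎_)
open import Relation.Nullary using (¬_)
open import Relation.Binary.PropositionalEquality using (_≡_; _≢_)
open import Function.Definitions using (Injective)

record Graph : Set where
  field
    n     : ℕ
    adj   : Fin n → Fin n → Bool
    sym   : ∀ u v → adj u v ≡ adj v u
    loopless : ∀ v → adj v v ≡ false
open Graph public

deg : (G : Graph) → Fin (n G) → ℕ
deg G v = sum (map (λ u → if adj G v u then 1 else 0) (allFin (n G)))

-- minimum degree δ(G) ≥ d (for a graph with at least one vertex)
MinDegGe : Graph → ℕ → Set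
MinDegGe G d = ∀ v → d ≤ deg G v

next : ∀ {k} → Fin k → Fin k
next {suc k} i = fromℕ< (m%n<n (suc (toℕ i)) (suc k))

HasCycle : Graph → ℕ → Set
HasCycle G k = 3 ≤ k × Σ (Fin k → Fin (n G)) λ f →
  Injective _≡_ _≡_ f × (∀ i → adj G (f i) (f (next i)) ≡ true)

GirthEq : Graph → ℕ → Set
GirthEq G m = HasCycle G m × (∀ k → k < m → ¬ HasCycle G k)

-- girth g(G) ≥ m  (includes forests, whose girth is ∞)
GirthGe : Graph → ℕ → Set
GirthGe G m = ∀ k → k < m → ¬ HasCycle G k

-- A spanning subgraph of G: a symmetric Boolean edge-selection
-- contained in E(G); the vertex set is all of Fin n.
record SpanningSubgraph (G : Graph) : Set where
  field
    sel    : Fin (n G) → Fin (n G) → Bool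
    selSym : ∀ u v → sel u v ≡ sel v u
    selSub : ∀ u v → sel u v ≡ true → adj G u v ≡ true
open SpanningSubgraph public

data Reach {G : Graph} (H : SpanningSubgraph G) (u : Fin (n G)) : Fin (n G) → Set where
  here : Reach H u u
  step : ∀ {v x} → Reach H u v → sel H v x ≡ true → Reach H u x

-- The connected component of v in H is a star K_{1,m} (m ≥ 1) with
-- centre c: c lies in the component, the component has another vertex,
-- and the edges of H among component vertices are exactly the pairs {c,x}.
ComponentIsStar : {G : Graph} → SpanningSubgraph G → Fin (n G) → Set
ComponentIsStar {G} H v = Σ (Fin (n G)) λ c →
  Reach H v c ×
  (∃ λ x → Reach H v x × x ≢ c) ×
  (∀ x y → Reach H v x → Reach H v y →
     (sel H x y ≡ true → (x ≡ c × y ≢ c) ⊎ (y ≡ c × x ≢ c)) ×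
     ((x ≡ c × y ≢ c) ⊎ (y ≡ c × x ≢ c) → sel H x y ≡ true))

IsStarFactor : {G : Graph} → SpanningSubgraph G → Set
IsStarFactor H = ∀ v → ComponentIsStar H v

-- edge-weighting: symmetric, positive integer on every edge
-- (values on non-edges are irrelevant)
record EdgeWeighting (G : Graph) : Set where
  field
    wt    : Fin (n G) → Fin (n G) → ℕ
    wtSym : ∀ u v → wt u v ≡ wt v u
    wtPos : ∀ u v → adj G u v ≡ true → 1 ≤ wt u v
open EdgeWeighting public

-- weight of a spanning subgraph: sum of w(e) over its edges
-- (each edge {u,v} counted once, via toℕ u < toℕ v)
weight : {G : Graph} → EdgeWeighting G → SpanningSubgraph G → ℕ
weight {G} w H = sum (map (λ u → sum (map (λ v →
  if (toℕ u <ᵇ toℕ v) ∧ sel H u v then wt w u v else 0)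
  (allFin (n G)))) (allFin (n G)))

InΩ : Graph → Set
InΩ G = Σ (EdgeWeighting G) λ w →
  ∀ (H₁ H₂ : SpanningSubgraph G) → IsStarFactor H₁ → IsStarFactor H₂ →
    weight w H₁ ≡ weight w H₂

module Submission where

-- Suppose an edge-weighting w gives all star-factors the same weight. Let C be a 6-cycle or a
-- path on 8 or 9 vertices in G such that every vertex outside C has a neighbour outside C.
-- Then the graph outside C has a star-factor F, and F together with any star-factor of C is a
-- star-factor of G; hence all star-factors of C have the same weight, and comparing two pairs
-- of them forces a positive edge weight to vanish.
-- Such a C exists. A vertex outside C without outside neighbours has, by δ ≥ 2, two neighbours
-- on C and closes a cycle with a shortest walk between them on C. For a 6-cycle C that cycle is
-- shorter than 6, which settles g(G) = 6. If g(G) ≥ 8 the same holds for 8- and 9-cycles, so G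
-- has none; a longest path, whose end closes a cycle of length at least 8, contains a path C on
-- 8 vertices, and the cycle closed there has length at most 9, so it cannot exist either.

open import Defs hiding (sym)
open import Data.Nat using (ℕ; zero; suc; pred; _+_; _≤_; _<_; _<ᵇ_; _≤ᵇ_; _≤?_; _%_; NonZero; >-nonZero⁻¹; z≤n; s≤s)
open import Data.Nat.DivMod using (m%n<n; m<n⇒m%n≡m; n%n≡0)
open import Data.Nat.Properties
  using (+-0-commutativeMonoid; +-identityʳ; <-cmp; <-asym; <ᵇ⇒<; <⇒<ᵇ; ≤ᵇ⇒≤;
         +-cancelˡ-≡; m≢1+n+m; ≤-trans; ≤-pred; m≤n⇒m<n∨m≡n; +-suc; 1+n≰n; n≤1+n; ≰⇒>; ≤-refl; +-mono-≤)
open import Data.Nat.ListAction using (sum)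
open import Data.Nat.Tactic.RingSolver using (solve-∀)
open import Algebra.Properties.CommutativeMonoid.Sum +-0-commutativeMonoid
  using (sum-syntax; ∑-distrib-+; sum-cong-≗; sum-replicate-zero)
  renaming (sum to ∑)
open import Data.Fin using (Fin; toℕ; zero; suc; #_; fromℕ<; inject≤)
open import Data.Fin.Properties using (_≟_; toℕ-injective; any?; all?; toℕ-fromℕ<; toℕ-inject≤; toℕ<n; injective⇒≤)
open import Data.List using (List; []; _∷_; _++_; map; allFin; tabulate; length; lookup; cartesianProduct)
open import Data.List.Properties using (map-tabulate)
open import Data.List.Membership.Propositional using (_∈_)
open import Data.List.Membership.Propositional.Properties using (∈-cartesianProduct⁺; ∈-allFin)
open import Data.List.Relation.Unary.Any using (here; there)
open import Data.Bool using (Bool; true; false; if_then_else_; _∧_; _∨_; not; T) renaming (_≟_ to _≟ᴮ_)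
open import Data.Bool.Properties using (∧-comm; ∨-comm; ∧-zeroʳ; ∨-zeroʳ)
open import Data.Unit using (tt)
open import Data.Maybe using (Maybe; nothing; just)
open import Data.Product using (Σ; ∃; _×_; _,_; proj₁; proj₂)
open import Data.Sum using (_⊎_; inj₁; inj₂; [_,_]′)
open import Data.Empty using (⊥; ⊥-elim)
open import Relation.Nullary using (¬_; yes; no; Dec; does; ¬?)
open import Relation.Nullary.Decidable using (_×-dec_; decidable-stable)
open import Relation.Binary using (tri<; tri≈; tri>)
open import Relation.Binary.PropositionalEquality
  using (_≡_; _≢_; refl; sym; trans; cong; cong₂; subst; module ≡-Reasoning)
open import Function using (_∘_; id)
open import Function.Definitions using (Injective)

∧-elim : ∀ {a b} → a ∧ b ≡ true → a ≡ true × b ≡ true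
∧-elim {true} e = refl , e

∧-intro : ∀ {a b} → a ≡ true → b ≡ true → a ∧ b ≡ true
∧-intro refl refl = refl

∨-elim : ∀ {a b} → a ∨ b ≡ true → a ≡ true ⊎ b ≡ true
∨-elim {true}  _ = inj₁ refl
∨-elim {false} e = inj₂ e

not-elim : ∀ {a} → not a ≡ true → a ≡ false
not-elim {false} _ = refl

⇒-elim : ∀ {a b} → not a ∨ b ≡ true → a ≡ true → b ≡ true
⇒-elim {true} e refl = e

<ᵇ-sound : ∀ {k g} → (k <ᵇ g) ≡ true → k < g
<ᵇ-sound {k} {g} e = <ᵇ⇒< k g (subst T (sym e) tt)

allᵇ : ∀ {m} → (Fin m → Bool) → Bool
allᵇ {zero}  p = true
allᵇ {suc m} p = p zero ∧ allᵇ (p ∘ suc)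

anyᵇ : ∀ {m} → (Fin m → Bool) → Bool
anyᵇ {zero}  p = false
anyᵇ {suc m} p = p zero ∨ anyᵇ (p ∘ suc)

allᵇ-sound : ∀ {m} (p : Fin m → Bool) → allᵇ p ≡ true → ∀ i → p i ≡ true
allᵇ-sound p e zero    = proj₁ (∧-elim e)
allᵇ-sound p e (suc i) = allᵇ-sound (p ∘ suc) (proj₂ (∧-elim {p zero} e)) i

allᵇ₂-sound : ∀ {m} (p : Fin m → Fin m → Bool) → allᵇ (λ i → allᵇ (p i)) ≡ true →
              ∀ i j → p i j ≡ true
allᵇ₂-sound p e i = allᵇ-sound (p i) (allᵇ-sound _ e i)

anyᵇ-sound : ∀ {m} (p : Fin m → Bool) → anyᵇ p ≡ true → ∃ λ i → p i ≡ true
anyᵇ-sound {suc m} p e with ∨-elim {p zero} e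
... | inj₁ p₀ = zero , p₀
... | inj₂ e′ with anyᵇ-sound (p ∘ suc) e′
...   | i , pᵢ = suc i , pᵢ

anyᵇ-false : ∀ {m} (p : Fin m → Bool) → anyᵇ p ≡ false → ∀ i → p i ≡ false
anyᵇ-false {suc m} p e zero    with p zero
... | false = refl
anyᵇ-false {suc m} p e (suc i) with p zero
... | false = anyᵇ-false (p ∘ suc) e i

infix 7 _≡ᵇ_
_≡ᵇ_ : ∀ {m} → Fin m → Fin m → Bool
i ≡ᵇ j = does (i ≟ j)

≡ᵇ⇒≡ : ∀ {m} {i j : Fin m} → i ≡ᵇ j ≡ true → i ≡ j
≡ᵇ⇒≡ {i = i} {j} e with i ≟ j
... | yes i≡j = i≡j

≡ᵇ-refl : ∀ {m} (i : Fin m) → (i ≡ᵇ i) ≡ true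
≡ᵇ-refl i with i ≟ i
... | yes _  = refl
... | no i≢i = ⊥-elim (i≢i refl)

≢⇒≡ᵇ-false : ∀ {m} {i j : Fin m} → i ≢ j → (i ≡ᵇ j) ≡ false
≢⇒≡ᵇ-false {i = i} {j} i≢j with i ≟ j
... | yes i≡j = ⊥-elim (i≢j i≡j)
... | no _    = refl

≡ᵇ-false⇒≢ : ∀ {m} {i j : Fin m} → (i ≡ᵇ j) ≡ false → i ≢ j
≡ᵇ-false⇒≢ {i = i} e refl with trans (sym (≡ᵇ-refl i)) e
... | ()

sum-allFin : ∀ {m} (f : Fin m → ℕ) → sum (map f (allFin m)) ≡ ∑[ i < m ] f i
sum-allFin {m} f = trans (cong sum (map-tabulate id f)) (sum-tabulate f)
  where
  sum-tabulate : ∀ {k} (g : Fin k → ℕ) → sum (tabulate g) ≡ ∑ g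
  sum-tabulate {zero}  g = refl
  sum-tabulate {suc k} g = cong (g zero +_) (sum-tabulate (g ∘ suc))

∑-zero : ∀ {m} (f : Fin m → ℕ) → (∀ i → f i ≡ 0) → ∑ f ≡ 0
∑-zero {m} f f≡0 = trans (sum-cong-≗ f≡0) (sum-replicate-zero m)

∑-indicator : ∀ {m} (a : Fin m) (c : ℕ) → ∑[ i < m ] (if i ≡ᵇ a then c else 0) ≡ c
∑-indicator {suc m} zero c = trans (cong (c +_) (∑-zero {m} _ (λ _ → refl))) (+-identityʳ c)
∑-indicator {suc m} (suc a) c = ∑-indicator a c

-- Weights of Boolean edge relations

BoolRel : ℕ → Set
BoolRel N = Fin N → Fin N → Bool

_∪ᵇ_ : ∀ {N} → BoolRel N → BoolRel N → BoolRel N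
(S ∪ᵇ T) u v = S u v ∨ T u v

edgeᵇ : ∀ {N} → Fin N → Fin N → BoolRel N
edgeᵇ a b u v = (u ≡ᵇ a ∧ v ≡ᵇ b) ∨ (u ≡ᵇ b ∧ v ≡ᵇ a)

edgeᵇ-sym : ∀ {N} (a b u v : Fin N) → edgeᵇ a b u v ≡ edgeᵇ a b v u
edgeᵇ-sym a b u v =
  trans (∨-comm (u ≡ᵇ a ∧ v ≡ᵇ b) _) (cong₂ _∨_ (∧-comm (u ≡ᵇ b) _) (∧-comm (u ≡ᵇ a) _))

edgeᵇ-false : ∀ {N} {a b u v : Fin N} → (u ≢ a ⊎ v ≢ b) → (u ≢ b ⊎ v ≢ a) → edgeᵇ a b u v ≡ false
edgeᵇ-false p q = cong₂ _∨_ (∧-false p) (∧-false q)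
  where
  ∧-false : ∀ {N} {u v a b : Fin N} → (u ≢ a ⊎ v ≢ b) → (u ≡ᵇ a ∧ v ≡ᵇ b) ≡ false
  ∧-false (inj₁ u≢a) rewrite ≢⇒≡ᵇ-false u≢a = refl
  ∧-false {u = u} {a = a} (inj₂ v≢b) rewrite ≢⇒≡ᵇ-false v≢b = ∧-zeroʳ (u ≡ᵇ a)

edgeᵇ-refl : ∀ {N} (a b : Fin N) → edgeᵇ a b a b ≡ true
edgeᵇ-refl a b rewrite ≡ᵇ-refl a | ≡ᵇ-refl b = refl

module EdgeSum {N : ℕ} (w : Fin N → Fin N → ℕ) where

  contribution : BoolRel N → Fin N → Fin N → ℕ
  contribution S u v = if (toℕ u <ᵇ toℕ v) ∧ S u v then w u v else 0

  edgeSum : BoolRel N → ℕ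
  edgeSum S = ∑[ u < N ] ∑[ v < N ] contribution S u v

  edgeSum-cong : ∀ {S T} → (∀ u v → S u v ≡ T u v) → edgeSum S ≡ edgeSum T
  edgeSum-cong S≡T = sum-cong-≗ λ u → sum-cong-≗ λ v →
    cong (λ b → if (toℕ u <ᵇ toℕ v) ∧ b then w u v else 0) (S≡T u v)

  edgeSum-empty : ∀ S → (∀ u v → S u v ≡ false) → edgeSum S ≡ 0
  edgeSum-empty S S≡false = ∑-zero _ λ u → ∑-zero _ λ v → zero-if (toℕ u <ᵇ toℕ v) (S≡false u v)
    where
    zero-if : ∀ l {b x} → b ≡ false → (if l ∧ b then x else 0) ≡ 0
    zero-if false refl = refl
    zero-if true  refl = refl

  edgeSum-∪ : ∀ S T → (∀ u v → S u v ∧ T u v ≡ false) → edgeSum (S ∪ᵇ T) ≡ edgeSum S + edgeSum T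
  edgeSum-∪ S T disjoint =
    trans (sum-cong-≗ λ u → trans (sum-cong-≗ λ v → split (toℕ u <ᵇ toℕ v) (S u v) (T u v) (disjoint u v))
                                  (∑-distrib-+ (contribution S u) (contribution T u)))
          (∑-distrib-+ (λ u → ∑ (contribution S u)) (λ u → ∑ (contribution T u)))
    where
    split : ∀ l a b {x} → a ∧ b ≡ false →
      (if l ∧ (a ∨ b) then x else 0) ≡ (if l ∧ a then x else 0) + (if l ∧ b then x else 0)
    split false a     b     _ = refl
    split true  true  false _ = sym (+-identityʳ _)
    split true  false true  _ = refl
    split true  false false _ = refl

  module _ (w-sym : ∀ u v → w u v ≡ w v u) {a b : Fin N} (a≢b : a ≢ b) where
    private
      wᵃᵇ wᵇᵃ : ℕ
      wᵃᵇ = if toℕ a <ᵇ toℕ b then w a b else 0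
      wᵇᵃ = if toℕ b <ᵇ toℕ a then w b a else 0

      row : Fin N → Fin N → ℕ
      row u v = (if u ≡ᵇ a then (if v ≡ᵇ b then wᵃᵇ else 0) else 0)
              + (if u ≡ᵇ b then (if v ≡ᵇ a then wᵇᵃ else 0) else 0)

      zero-if : ∀ l {x} → (if l ∧ false then x else 0) ≡ 0
      zero-if false = refl
      zero-if true  = refl

      keep-if : ∀ l {x} → (if l ∧ true then x else 0) ≡ (if l then x else 0)
      keep-if false = refl
      keep-if true  = refl

      contribution-edge : ∀ u v → contribution (edgeᵇ a b) u v ≡ row u v
      contribution-edge u v with u ≟ a | u ≟ b | v ≟ a | v ≟ b
      ... | yes refl | yes refl | _        | _        = ⊥-elim (a≢b refl)
      ... | _        | _        | yes refl | yes refl = ⊥-elim (a≢b refl)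
      ... | yes refl | no _     | no _     | yes refl = trans (keep-if (toℕ u <ᵇ toℕ v)) (sym (+-identityʳ _))
      ... | no _     | yes refl | yes refl | no _     = keep-if (toℕ u <ᵇ toℕ v)
      ... | yes _    | no _     | yes _    | no _     = zero-if (toℕ u <ᵇ toℕ v)
      ... | yes _    | no _     | no _     | no _     = zero-if (toℕ u <ᵇ toℕ v)
      ... | no _     | yes _    | no _     | yes _    = zero-if (toℕ u <ᵇ toℕ v)
      ... | no _     | yes _    | no _     | no _     = zero-if (toℕ u <ᵇ toℕ v)
      ... | no _     | no _     | _        | _        = zero-if (toℕ u <ᵇ toℕ v)

      ∑-guarded : ∀ c d x → ∑[ v < N ] (if c then (if v ≡ᵇ d then x else 0) else 0) ≡ (if c then x else 0)
      ∑-guarded false d x = ∑-zero {N} _ (λ _ → refl)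
      ∑-guarded true  d x = ∑-indicator d x

      -- exactly one of the two orientations of {a, b} is counted
      wᵃᵇ+wᵇᵃ : wᵃᵇ + wᵇᵃ ≡ w a b
      wᵃᵇ+wᵇᵃ with toℕ a <ᵇ toℕ b in a<b | toℕ b <ᵇ toℕ a in b<a
      ... | true  | true  = ⊥-elim (<-asym (<ᵇ-sound {toℕ a} a<b) (<ᵇ-sound {toℕ b} b<a))
      ... | true  | false = +-identityʳ _
      ... | false | true  = w-sym b a
      ... | false | false with <-cmp (toℕ a) (toℕ b)
      ...   | tri< lt _ _ = ⊥-elim (subst T a<b (<⇒<ᵇ lt))
      ...   | tri≈ _ eq _ = ⊥-elim (a≢b (toℕ-injective eq))
      ...   | tri> _ _ gt = ⊥-elim (subst T b<a (<⇒<ᵇ gt))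

    edgeSum-edge : edgeSum (edgeᵇ a b) ≡ w a b
    edgeSum-edge =
      trans (sum-cong-≗ λ u →
               trans (sum-cong-≗ (contribution-edge u))
                     (trans (∑-distrib-+ {N} _ _)
                            (cong₂ _+_ (∑-guarded (u ≡ᵇ a) b wᵃᵇ) (∑-guarded (u ≡ᵇ b) a wᵇᵃ))))
            (trans (∑-distrib-+ {N} _ _)
                   (trans (cong₂ _+_ (∑-indicator a wᵃᵇ) (∑-indicator b wᵇᵃ)) wᵃᵇ+wᵇᵃ))

open EdgeSum using (edgeSum; edgeSum-cong; edgeSum-empty; edgeSum-∪; edgeSum-edge)

weight≡edgeSum : {G : Graph} (w : EdgeWeighting G) (H : SpanningSubgraph G) →
                 weight w H ≡ edgeSum (wt w) (sel H)
weight≡edgeSum {G} w H =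
  trans (sum-allFin {n G} _) (sum-cong-≗ λ u → sum-allFin (EdgeSum.contribution (wt w) (sel H) u))

-- Star-factors from pendant edges

module _ {N : ℕ} where

  _⊆ᵇ_ : BoolRel N → BoolRel N → Set
  S ⊆ᵇ T = ∀ u v → S u v ≡ true → T u v ≡ true

  SymmetricRel : BoolRel N → Set
  SymmetricRel S = ∀ u v → S u v ≡ S v u

  Covers : (Fin N → Set) → BoolRel N → Set
  Covers P S = ∀ v → P v → ∃ λ u → S v u ≡ true

  PendantAt : BoolRel N → Fin N → Fin N → Set
  PendantAt S u v = ∀ x → S u x ≡ true → x ≡ v

  PendantEdge : BoolRel N → Fin N → Fin N → Set
  PendantEdge S a b = S a b ≡ true → PendantAt S a b ⊎ PendantAt S b a

  hasOtherNbr : BoolRel N → Fin N → Fin N → Bool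
  hasOtherNbr S a b = anyᵇ λ x → not (x ≡ᵇ b) ∧ S a x

  hasOtherNbr-sound : ∀ S a b → hasOtherNbr S a b ≡ true → ∃ λ x → x ≢ b × S a x ≡ true
  hasOtherNbr-sound S a b e with anyᵇ-sound (λ x → not (x ≡ᵇ b) ∧ S a x) e
  ... | x , p with ∧-elim {not (x ≡ᵇ b)} p
  ...   | x≢b , Sax = x , ≡ᵇ-false⇒≢ (not-elim x≢b) , Sax

  hasOtherNbr-false : ∀ S a b → hasOtherNbr S a b ≡ false → PendantAt S a b
  hasOtherNbr-false S a b e x Sax with x ≟ b
  ... | yes x≡b = x≡b
  ... | no  x≢b with anyᵇ-false (λ x → not (x ≡ᵇ b) ∧ S a x) e x
  ...   | r rewrite ≢⇒≡ᵇ-false x≢b | Sax with r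
  ...     | ()

  PendantEdge-⊆ : ∀ {S T} → T ⊆ᵇ S → ∀ a b → PendantEdge S a b → PendantEdge T a b
  PendantEdge-⊆ T⊆S a b pend Tab with pend (T⊆S a b Tab)
  ... | inj₁ a-leaf = inj₁ λ x Tax → a-leaf x (T⊆S a x Tax)
  ... | inj₂ b-leaf = inj₂ λ x Tbx → b-leaf x (T⊆S b x Tbx)

module _ {G : Graph} (H : SpanningSubgraph G) where
  private
    V = Fin (n G)
    S = sel H

    loopless-sel : ∀ {x y} → S x y ≡ true → x ≢ y
    loopless-sel {x} Sxy refl with trans (sym (selSub H x x Sxy)) (loopless G x)
    ... | ()

    pendantAt? : ∀ u v → Dec (PendantAt S u v)
    pendantAt? u v = all? λ x → implies (S u x) (x ≟ v)
      where
      implies : ∀ b {x} → Dec (x ≡ v) → Dec (b ≡ true → x ≡ v)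
      implies false _          = yes λ ()
      implies true  (yes x≡v) = yes λ _ → x≡v
      implies true  (no x≢v)  = no λ f → x≢v (f refl)

    Centre : V → Set
    Centre c = ∀ x → S c x ≡ true → PendantAt S x c

    star-around : ∀ v c → Centre c → (v ≡ c ⊎ S c v ≡ true) → ∀ t → S c t ≡ true → ComponentIsStar H v
    star-around v c centre v∈star t Sct = c , reach-c v∈star , (t , step (reach-c v∈star) Sct , t≢c) , edges
      where
      t≢c : t ≢ c
      t≢c t≡c = loopless-sel Sct (sym t≡c)

      InStar : V → Set
      InStar x = x ≡ c ⊎ S c x ≡ true

      closed : ∀ {x y} → InStar x → S x y ≡ true → InStar y
      closed (inj₁ refl) Scy = inj₂ Scy
      closed (inj₂ Scx)  Sxy = inj₁ (centre _ Scx _ Sxy)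

      reach⇒InStar : ∀ {x} → Reach H v x → InStar x
      reach⇒InStar here       = v∈star
      reach⇒InStar (step r e) = closed (reach⇒InStar r) e

      reach-c : (v ≡ c ⊎ S c v ≡ true) → Reach H v c
      reach-c (inj₁ refl) = here
      reach-c (inj₂ Scv)  = step here (trans (selSym H v c) Scv)

      edges : ∀ x y → Reach H v x → Reach H v y →
        (S x y ≡ true → (x ≡ c × y ≢ c) ⊎ (y ≡ c × x ≢ c)) ×
        ((x ≡ c × y ≢ c) ⊎ (y ≡ c × x ≢ c) → S x y ≡ true)
      edges x y rx ry = only-spokes , all-spokes
        where
        only-spokes : S x y ≡ true → (x ≡ c × y ≢ c) ⊎ (y ≡ c × x ≢ c)
        only-spokes Sxy with reach⇒InStar rx
        ... | inj₁ refl = inj₁ (refl , λ y≡c → loopless-sel Sxy (sym y≡c))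
        ... | inj₂ Scx  = inj₂ (centre x Scx y Sxy , λ x≡c → loopless-sel Scx (sym x≡c))
        all-spokes : (x ≡ c × y ≢ c) ⊎ (y ≡ c × x ≢ c) → S x y ≡ true
        all-spokes (inj₁ (refl , y≢c)) with reach⇒InStar ry
        ... | inj₁ y≡c = ⊥-elim (y≢c y≡c)
        ... | inj₂ Scy = Scy
        all-spokes (inj₂ (refl , x≢c)) with reach⇒InStar rx
        ... | inj₁ x≡c = ⊥-elim (x≢c x≡c)
        ... | inj₂ Scx = trans (selSym H x y) Scx

  pendant-cover⇒star-factor : (∀ v → ∃ λ u → S v u ≡ true) → (∀ a b → PendantEdge S a b) → IsStarFactor H
  pendant-cover⇒star-factor covers pendant v with covers v
  ... | u , Svu with pendantAt? v u
  ...   | yes v-leaf = star-around v u u-centre (inj₂ (trans (selSym H u v) Svu)) v (trans (selSym H u v) Svu)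
    where
    u-centre : Centre u
    u-centre x Sux with pendant u x Sux
    ... | inj₂ x-leaf = x-leaf
    ... | inj₁ u-leaf with u-leaf v (trans (selSym H u v) Svu)
    ...   | refl = v-leaf
  ...   | no ¬v-leaf = star-around v v v-centre (inj₁ refl) u Svu
    where
    v-centre : Centre v
    v-centre x Svx with pendant v x Svx
    ... | inj₂ x-leaf = x-leaf
    ... | inj₁ v-leaf with v-leaf u Svu
    ...   | refl = ⊥-elim (¬v-leaf v-leaf)

record PendantSubrel {N : ℕ} (S₀ : BoolRel N) (P : Fin N → Set) : Set where
  field
    rel       : BoolRel N
    symmetric : SymmetricRel rel
    ⊆S₀       : rel ⊆ᵇ S₀
    covers    : Covers P rel
    pendant   : ∀ a b → PendantEdge rel a b

-- Greedy pruning: delete an edge ab whenever both a and b have other neighbours.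
-- Deletion preserves covering, and an edge ab that survives its turn stays pendant under later deletions.
module _ {N : ℕ} (S₀ : BoolRel N) (S₀-sym : SymmetricRel S₀) (S₀-irrefl : ∀ v → S₀ v v ≡ false)
         (P : Fin N → Set) (S₀-covers : Covers P S₀) where
  private
    removeEdge : Fin N → Fin N → BoolRel N → BoolRel N
    removeEdge a b S u v = S u v ∧ not (edgeᵇ a b u v)

    removable : BoolRel N → Fin N → Fin N → Bool
    removable S a b = S a b ∧ (hasOtherNbr S a b ∧ hasOtherNbr S b a)

    prune : Fin N → Fin N → BoolRel N → BoolRel N
    prune a b S = if removable S a b then removeEdge a b S else S

    pruneAll : List (Fin N × Fin N) → BoolRel N → BoolRel N
    pruneAll []             S = S
    pruneAll ((a , b) ∷ ps) S = pruneAll ps (prune a b S)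

    record Invariant (S : BoolRel N) : Set where
      field
        symmetric : SymmetricRel S
        ⊆S₀       : S ⊆ᵇ S₀
        covers    : Covers P S

    module _ {S : BoolRel N} (inv : Invariant S) (a b : Fin N) where
      open Invariant inv

      prune-⊆ : prune a b S ⊆ᵇ S
      prune-⊆ u v e with removable S a b
      ... | true  = proj₁ (∧-elim e)
      ... | false = e

      prune-invariant : Invariant (prune a b S)
      prune-invariant with removable S a b in rem
      ... | false = inv
      ... | true  = record { symmetric = sym′ ; ⊆S₀ = λ u v e → ⊆S₀ u v (proj₁ (∧-elim e)) ; covers = covers′ }
        where
        sym′ : SymmetricRel (removeEdge a b S)
        sym′ u v = cong₂ (λ x y → x ∧ not y) (symmetric u v) (edgeᵇ-sym a b u v)

        Sab : S a b ≡ true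
        Sab = proj₁ (∧-elim {S a b} rem)

        others : hasOtherNbr S a b ∧ hasOtherNbr S b a ≡ true
        others = proj₂ (∧-elim {S a b} rem)

        a≢b : a ≢ b
        a≢b refl with trans (sym (⊆S₀ a a Sab)) (S₀-irrefl a)
        ... | ()

        kept : ∀ {u x} → S u x ≡ true → (u ≢ a ⊎ x ≢ b) → (u ≢ b ⊎ x ≢ a) → removeEdge a b S u x ≡ true
        kept Sux p q = ∧-intro Sux (cong not (edgeᵇ-false p q))

        covers′ : Covers P (removeEdge a b S)
        covers′ v Pv = by-cases (v ≟ a) (v ≟ b)
          where
          by-cases : Dec (v ≡ a) → Dec (v ≡ b) → ∃ λ u → removeEdge a b S v u ≡ true
          by-cases (yes refl) _ with hasOtherNbr-sound S a b (proj₁ (∧-elim others))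
          ... | x , x≢b , Sax = x , kept Sax (inj₂ x≢b) (inj₁ a≢b)
          by-cases (no _) (yes refl) with hasOtherNbr-sound S b a (proj₂ (∧-elim {hasOtherNbr S a b} others))
          ... | x , x≢a , Sbx = x , kept Sbx (inj₁ (a≢b ∘ sym)) (inj₂ x≢a)
          by-cases (no v≢a) (no v≢b) with covers v Pv
          ... | u , Svu = u , kept Svu (inj₁ v≢a) (inj₁ v≢b)

      prune-pendant : PendantEdge (prune a b S) a b
      prune-pendant with removable S a b in rem
      ... | true = λ e → ⊥-elim (removed (proj₂ (∧-elim {S a b} e)))
        where
        removed : not (edgeᵇ a b a b) ≢ true
        removed e rewrite edgeᵇ-refl a b with e
        ... | ()
      ... | false = λ Sab → leaf (others-false Sab)
        where
        others-false : S a b ≡ true → hasOtherNbr S a b ∧ hasOtherNbr S b a ≡ false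
        others-false Sab = trans (cong (_∧ (hasOtherNbr S a b ∧ hasOtherNbr S b a)) (sym Sab)) rem
        leaf : hasOtherNbr S a b ∧ hasOtherNbr S b a ≡ false → PendantAt S a b ⊎ PendantAt S b a
        leaf e with hasOtherNbr S a b in ab
        ... | false = inj₁ (hasOtherNbr-false S a b ab)
        ... | true  = inj₂ (hasOtherNbr-false S b a e)

    pruneAll-correct : ∀ ps S → Invariant S →
      Invariant (pruneAll ps S) × (∀ a b → (a , b) ∈ ps → PendantEdge (pruneAll ps S) a b) × pruneAll ps S ⊆ᵇ S
    pruneAll-correct []             S inv = inv , (λ a b ()) , λ u v e → e
    pruneAll-correct ((a , b) ∷ ps) S inv with pruneAll-correct ps (prune a b S) (prune-invariant inv a b)
    ... | inv′ , pendant , ⊆prune = inv′ , pendant′ , λ u v e → prune-⊆ inv a b u v (⊆prune u v e)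
      where
      pendant′ : ∀ x y → (x , y) ∈ ((a , b) ∷ ps) → PendantEdge (pruneAll ps (prune a b S)) x y
      pendant′ x y (here refl) = PendantEdge-⊆ ⊆prune a b (prune-pendant inv a b)
      pendant′ x y (there xy∈ps) = pendant x y xy∈ps

  pendantSubrel : PendantSubrel S₀ P
  pendantSubrel = record
    { rel = pruneAll allPairs S₀ ; symmetric = symmetric ; ⊆S₀ = ⊆S₀ ; covers = covers
    ; pendant = λ a b → proj₁ (proj₂ correct) a b (∈-cartesianProduct⁺ (∈-allFin a) (∈-allFin b)) }
    where
    allPairs = cartesianProduct (allFin N) (allFin N)
    correct = pruneAll-correct allPairs S₀ (record { symmetric = S₀-sym ; ⊆S₀ = λ u v e → e ; covers = S₀-covers })
    open Invariant (proj₁ correct)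

-- Star patterns on paths and cycles

Pattern : ℕ → Set
Pattern L = List (Fin L × Fin L)

patternRel : ∀ {L} → Pattern L → BoolRel L
patternRel []             = λ _ _ → false
patternRel ((i , j) ∷ es) = edgeᵇ i j ∪ᵇ patternRel es

patternRel-sym : ∀ {L} (es : Pattern L) → SymmetricRel (patternRel es)
patternRel-sym []             u v = refl
patternRel-sym ((i , j) ∷ es) u v = cong₂ _∨_ (edgeᵇ-sym i j u v) (patternRel-sym es u v)

-- no loops and no repeated edges, so that the weight of the pattern is the sum over its list
disjointᵇ : ∀ {L} → Pattern L → Bool
disjointᵇ []             = true
disjointᵇ ((i , j) ∷ es) =
  not (i ≡ᵇ j) ∧ (allᵇ (λ u → allᵇ λ v → not (edgeᵇ i j u v ∧ patternRel es u v)) ∧ disjointᵇ es)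

-- `linked i` says that the pair i, next i is an edge of the path or cycle carried by Fin L
linkedPairᵇ : ∀ {L} → (Fin L → Bool) → Fin L → Fin L → Bool
linkedPairᵇ linked i j = (linked i ∧ j ≡ᵇ next i) ∨ (linked j ∧ i ≡ᵇ next j)

linkedEdgesᵇ : ∀ {L} → (Fin L → Bool) → BoolRel L → Bool
linkedEdgesᵇ linked p = allᵇ λ i → allᵇ λ j → not (p i j) ∨ linkedPairᵇ linked i j

module _ {L : ℕ} (p : BoolRel L) where

  coversᵇ : Bool
  coversᵇ = allᵇ λ i → anyᵇ (p i)

  pendantAtᵇ : Fin L → Fin L → Bool
  pendantAtᵇ i j = allᵇ λ k → not (p i k) ∨ k ≡ᵇ j

  pendantᵇ : Bool
  pendantᵇ = allᵇ λ i → allᵇ λ j → not (p i j) ∨ (pendantAtᵇ i j ∨ pendantAtᵇ j i)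

isStarPatternᵇ : ∀ {L} → (Fin L → Bool) → Pattern L → Bool
isStarPatternᵇ linked es =
  linkedEdgesᵇ linked (patternRel es) ∧ (coversᵇ (patternRel es) ∧ (pendantᵇ (patternRel es) ∧ disjointᵇ es))

record StarPattern {L : ℕ} (linked : Fin L → Bool) (es : Pattern L) : Set where
  private p = patternRel es
  field
    linked-edge : ∀ i j → p i j ≡ true → linkedPairᵇ linked i j ≡ true
    covers      : ∀ i → ∃ λ j → p i j ≡ true
    pendant     : ∀ i j → PendantEdge p i j
    disjoint    : disjointᵇ es ≡ true

starPattern-sound : ∀ {L} (linked : Fin L → Bool) (es : Pattern L) →
                    isStarPatternᵇ linked es ≡ true → StarPattern linked es
starPattern-sound linked es ok = record
  { linked-edge = λ i j → ⇒-elim (allᵇ₂-sound _ edges-ok i j)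
  ; covers      = λ i → anyᵇ-sound (p i) (allᵇ-sound _ covers-ok i)
  ; pendant     = λ i j pij → pendant (∨-elim (⇒-elim (allᵇ₂-sound _ pendant-ok i j) pij))
  ; disjoint    = disjoint-ok }
  where
  p = patternRel es
  edges-ok = proj₁ (∧-elim ok)
  rest = proj₂ (∧-elim {linkedEdgesᵇ linked p} ok)
  covers-ok = proj₁ (∧-elim rest)
  rest′ = proj₂ (∧-elim {coversᵇ p} rest)
  pendant-ok = proj₁ (∧-elim rest′)
  disjoint-ok = proj₂ (∧-elim {pendantᵇ p} rest′)

  pendantAt-sound : ∀ i j → pendantAtᵇ p i j ≡ true → PendantAt p i j
  pendantAt-sound i j e k pik = ≡ᵇ⇒≡ (⇒-elim (allᵇ-sound _ e k) pik)

  pendant : ∀ {i j} → pendantAtᵇ p i j ≡ true ⊎ pendantAtᵇ p j i ≡ true → PendantAt p i j ⊎ PendantAt p j i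
  pendant {i} {j} (inj₁ e) = inj₁ (pendantAt-sound i j e)
  pendant {i} {j} (inj₂ e) = inj₂ (pendantAt-sound j i e)

patternSum : ∀ {L} → (Fin L → Fin L → ℕ) → Pattern L → ℕ
patternSum c []             = 0
patternSum c ((i , j) ∷ es) = c i j + patternSum c es

record Embedding (G : Graph) (L : ℕ) : Set where
  field
    vertex    : Fin L → Fin (n G)
    injective : Injective _≡_ _≡_ vertex

module _ {G : Graph} {L : ℕ} (E : Embedding G L) where
  open Embedding E
  private V = Fin (n G)

  image? : ∀ v → Dec (∃ λ i → vertex i ≡ v)
  image? v = any? λ i → vertex i ≟ v

  outside : V → Bool
  outside v = not (does (image? v))

  NoIsolatedOutside : Set
  NoIsolatedOutside = ∀ v → outside v ≡ true → ∃ λ u → adj G v u ≡ true × outside u ≡ true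

  outside-vertex : ∀ i → outside (vertex i) ≡ false
  outside-vertex i with image? (vertex i)
  ... | yes _ = refl
  ... | no ∉ = ⊥-elim (∉ (i , refl))

  outside⇒≢vertex : ∀ {v} → outside v ≡ true → ∀ i → vertex i ≢ v
  outside⇒≢vertex out i refl with trans (sym out) (outside-vertex i)
  ... | ()

  inside⇒vertex : ∀ v → outside v ≡ false → ∃ λ i → vertex i ≡ v
  inside⇒vertex v inside with image? v
  ... | yes v∈ = v∈

  Linked : (Fin L → Bool) → Set
  Linked linked = ∀ i → linked i ≡ true → adj G (vertex i) (vertex (next i)) ≡ true

  linkedPair-adj : ∀ {linked} → Linked linked → ∀ i j → linkedPairᵇ linked i j ≡ true →
                   adj G (vertex i) (vertex j) ≡ true
  linkedPair-adj {linked} linked-adj i j e = [ forward , backward ]′ (∨-elim {linked i ∧ j ≡ᵇ next i} e)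
    where
    forward : linked i ∧ j ≡ᵇ next i ≡ true → adj G (vertex i) (vertex j) ≡ true
    forward e′ = subst (λ k → adj G (vertex i) (vertex k) ≡ true) (sym (≡ᵇ⇒≡ (proj₂ (∧-elim e′))))
                       (linked-adj i (proj₁ (∧-elim e′)))
    backward : linked j ∧ i ≡ᵇ next j ≡ true → adj G (vertex i) (vertex j) ≡ true
    backward e′ = subst (λ k → adj G (vertex k) (vertex j) ≡ true) (sym (≡ᵇ⇒≡ (proj₂ (∧-elim e′))))
                        (trans (Graph.sym G _ _) (linked-adj j (proj₁ (∧-elim e′))))

  lift : BoolRel L → BoolRel (n G)
  lift p u v with image? u | image? v
  ... | yes (i , _) | yes (j , _) = p i j
  ... | _           | _           = false

  lift-vertex : ∀ p i j → lift p (vertex i) (vertex j) ≡ p i j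
  lift-vertex p i j with image? (vertex i) | image? (vertex j)
  ... | yes (i′ , eᵢ) | yes (j′ , eⱼ) rewrite injective eᵢ | injective eⱼ = refl
  ... | no ∉ | _     = ⊥-elim (∉ (i , refl))
  ... | yes _ | no ∉ = ⊥-elim (∉ (j , refl))

  lift-sound : ∀ p u v → lift p u v ≡ true → ∃ λ i → ∃ λ j → vertex i ≡ u × vertex j ≡ v × p i j ≡ true
  lift-sound p u v e with image? u | image? v
  ... | yes (i , eᵢ) | yes (j , eⱼ) = i , j , eᵢ , eⱼ , e

  lift⇒inside : ∀ p u v → lift p u v ≡ true → outside u ≡ false
  lift⇒inside p u v e with lift-sound p u v e
  ... | i , _ , refl , _ = outside-vertex i

  lift-sym : ∀ p → SymmetricRel p → SymmetricRel (lift p)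
  lift-sym p p-sym u v with image? u | image? v
  ... | yes (i , _) | yes (j , _) = p-sym i j
  ... | yes _ | no _  = refl
  ... | no _  | yes _ = refl
  ... | no _  | no _  = refl

  lift-∪ : ∀ p q u v → lift (p ∪ᵇ q) u v ≡ (lift p ∪ᵇ lift q) u v
  lift-∪ p q u v with image? u | image? v
  ... | yes _ | yes _ = refl
  ... | yes _ | no _  = refl
  ... | no _  | yes _ = refl
  ... | no _  | no _  = refl

  lift-disjoint : ∀ p q → (∀ i j → p i j ∧ q i j ≡ false) → ∀ u v → lift p u v ∧ lift q u v ≡ false
  lift-disjoint p q disjoint u v with image? u | image? v
  ... | yes (i , _) | yes (j , _) = disjoint i j
  ... | yes _ | no _  = refl
  ... | no _  | yes _ = refl
  ... | no _  | no _  = refl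

  lift-empty : ∀ u v → lift (λ _ _ → false) u v ≡ false
  lift-empty u v with image? u | image? v
  ... | yes _ | yes _ = refl
  ... | yes _ | no _  = refl
  ... | no _  | yes _ = refl
  ... | no _  | no _  = refl

  ≡ᵇ-vertex : ∀ a i → vertex a ≡ᵇ vertex i ≡ a ≡ᵇ i
  ≡ᵇ-vertex a i with a ≟ i
  ... | yes refl = ≡ᵇ-refl (vertex a)
  ... | no a≢i   = ≢⇒≡ᵇ-false (a≢i ∘ injective)

  lift-edge : ∀ i j u v → lift (edgeᵇ i j) u v ≡ edgeᵇ (vertex i) (vertex j) u v
  lift-edge i j u v with image? u | image? v
  ... | yes (a , refl) | yes (b , refl)
    rewrite ≡ᵇ-vertex a i | ≡ᵇ-vertex a j | ≡ᵇ-vertex b i | ≡ᵇ-vertex b j = refl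
  ... | yes _ | no v∉ = sym (edgeᵇ-false {a = vertex i} {vertex j} {u} {v}
                          (inj₂ λ { refl → v∉ (j , refl) }) (inj₂ λ { refl → v∉ (i , refl) }))
  ... | no u∉ | _     = sym (edgeᵇ-false {a = vertex i} {vertex j} {u} {v}
                          (inj₁ λ { refl → u∉ (i , refl) }) (inj₁ λ { refl → u∉ (j , refl) }))

ConstantOnStarFactors : (G : Graph) → EdgeWeighting G → Set
ConstantOnStarFactors G w =
  ∀ (H₁ H₂ : SpanningSubgraph G) → IsStarFactor H₁ → IsStarFactor H₂ → weight w H₁ ≡ weight w H₂

module _ {G : Graph} {L : ℕ} (E : Embedding G L) (no-isolated : NoIsolatedOutside E) where
  open Embedding E
  private
    S₀ : BoolRel (n G)
    S₀ u v = adj G u v ∧ (outside E u ∧ outside E v)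

    S₀-sym : SymmetricRel S₀
    S₀-sym u v = cong₂ _∧_ (Graph.sym G u v) (∧-comm (outside E u) (outside E v))

    S₀-irrefl : ∀ v → S₀ v v ≡ false
    S₀-irrefl v rewrite loopless G v = refl

    S₀-covers : Covers (λ v → outside E v ≡ true) S₀
    S₀-covers v out with no-isolated v out
    ... | u , Avu , out-u = u , ∧-intro Avu (∧-intro out out-u)

    forest : PendantSubrel S₀ (λ v → outside E v ≡ true)
    forest = pendantSubrel S₀ S₀-sym S₀-irrefl _ S₀-covers

    open PendantSubrel forest
      renaming (rel to R; symmetric to R-sym; ⊆S₀ to R⊆S₀; covers to R-covers; pendant to R-pendant)

    R-outside : ∀ {u v} → R u v ≡ true → outside E u ≡ true
    R-outside {u} {v} Ruv = proj₁ (∧-elim (proj₂ (∧-elim {adj G u v} (R⊆S₀ u v Ruv))))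

    R-lift-disjoint : ∀ p u v → R u v ∧ lift E p u v ≡ false
    R-lift-disjoint p u v with R u v in Ruv | lift E p u v in Puv
    ... | false | _     = refl
    ... | true  | false = refl
    ... | true  | true  with trans (sym (R-outside Ruv)) (lift⇒inside E p u v Puv)
    ...   | ()

  module _ (linked : Fin L → Bool) (linked-adj : Linked E linked) (es : Pattern L) (pat : StarPattern linked es) where
    private
      open StarPattern pat renaming (covers to p-covers; pendant to p-pendant)
      p = patternRel es
      P = lift E p

      P-adj : ∀ u v → P u v ≡ true → adj G u v ≡ true
      P-adj u v Puv with lift-sound E p u v Puv
      ... | i , j , refl , refl , pij = linkedPair-adj E linked-adj i j (linked-edge i j pij)

      H-sel = R ∪ᵇ P

      H-covers : ∀ v → ∃ λ u → H-sel v u ≡ true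
      H-covers v with outside E v in out
      ... | true with R-covers v out
      ...   | u , Rvu = u , cong (_∨ P v u) Rvu
      H-covers v | false with inside⇒vertex E v out
      ...   | i , refl with p-covers i
      ...     | j , pij = vertex j , trans (cong (R (vertex i) (vertex j) ∨_) (trans (lift-vertex E p i j) pij))
                                           (∨-zeroʳ _)

      pendantR : ∀ u v → R u v ≡ true → PendantAt R u v → PendantAt H-sel u v
      pendantR u v Ruv leaf x Hux with ∨-elim {R u x} Hux
      ... | inj₁ Rux = leaf x Rux
      ... | inj₂ Pux with trans (sym (R-outside Ruv)) (lift⇒inside E p u x Pux)
      ...   | ()

      pendantP : ∀ i j → PendantAt p i j → PendantAt H-sel (vertex i) (vertex j)
      pendantP i j leaf x Hix with ∨-elim {R (vertex i) x} Hix
      ... | inj₁ Rix with trans (sym (R-outside Rix)) (outside-vertex E i)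
      ...   | ()
      pendantP i j leaf x Hix | inj₂ Pix with lift-sound E p (vertex i) x Pix
      ... | i′ , k , vi′≡vi , refl , pi′k with injective vi′≡vi
      ...   | refl = cong vertex (leaf k pi′k)

      H-pendant : ∀ u v → PendantEdge H-sel u v
      H-pendant u v Huv with ∨-elim {R u v} Huv
      ... | inj₁ Ruv with R-pendant u v Ruv
      ...   | inj₁ leaf = inj₁ (pendantR u v Ruv leaf)
      ...   | inj₂ leaf = inj₂ (pendantR v u (trans (R-sym v u) Ruv) leaf)
      H-pendant u v Huv | inj₂ Puv with lift-sound E p u v Puv
      ... | i , j , refl , refl , pij with p-pendant i j pij
      ...   | inj₁ leaf = inj₁ (pendantP i j leaf)
      ...   | inj₂ leaf = inj₂ (pendantP j i leaf)

    extendPattern : SpanningSubgraph G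
    extendPattern = record
      { sel    = H-sel
      ; selSym = λ u v → cong₂ _∨_ (R-sym u v) (lift-sym E p (patternRel-sym es) u v)
      ; selSub = λ u v Huv → [ (λ Ruv → proj₁ (∧-elim (R⊆S₀ u v Ruv))) , P-adj u v ]′ (∨-elim {R u v} Huv) }

    extendPattern-isStarFactor : IsStarFactor extendPattern
    extendPattern-isStarFactor = pendant-cover⇒star-factor extendPattern H-covers H-pendant

    weight-extendPattern : (w : EdgeWeighting G) →
      weight w extendPattern ≡ edgeSum (wt w) R + patternSum (λ i j → wt w (vertex i) (vertex j)) es
    weight-extendPattern w =
      trans (weight≡edgeSum w extendPattern)
            (trans (edgeSum-∪ (wt w) R P (R-lift-disjoint p))
                   (cong (edgeSum (wt w) R +_) (edgeSum-lift es disjoint)))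
      where
      edgeSum-lift : ∀ qs → disjointᵇ qs ≡ true →
        edgeSum (wt w) (lift E (patternRel qs)) ≡ patternSum (λ i j → wt w (vertex i) (vertex j)) qs
      edgeSum-lift [] _ = edgeSum-empty (wt w) _ (lift-empty E)
      edgeSum-lift ((i , j) ∷ qs) d =
        trans (edgeSum-cong (wt w) (lift-∪ E (edgeᵇ i j) (patternRel qs)))
        (trans (edgeSum-∪ (wt w) _ _ (lift-disjoint E (edgeᵇ i j) (patternRel qs) separate))
        (cong₂ _+_ (trans (edgeSum-cong (wt w) (lift-edge E i j)) (edgeSum-edge (wt w) (wtSym w) vi≢vj))
                   (edgeSum-lift qs (proj₂ (∧-elim rest)))))
        where
        i≢j = ≡ᵇ-false⇒≢ (not-elim (proj₁ (∧-elim d)))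
        rest = proj₂ (∧-elim {not (i ≡ᵇ j)} d)
        vi≢vj : vertex i ≢ vertex j
        vi≢vj = i≢j ∘ injective
        separate : ∀ u v → edgeᵇ i j u v ∧ patternRel qs u v ≡ false
        separate u v = not-elim (allᵇ₂-sound _ (proj₁ (∧-elim rest)) u v)

  patternSum-constant : (w : EdgeWeighting G) → ConstantOnStarFactors G w →
    (linked : Fin L → Bool) → Linked E linked →
    ∀ es₁ es₂ → StarPattern linked es₁ → StarPattern linked es₂ →
    patternSum (λ i j → wt w (vertex i) (vertex j)) es₁ ≡ patternSum (λ i j → wt w (vertex i) (vertex j)) es₂
  patternSum-constant w constant linked linked-adj es₁ es₂ pat₁ pat₂ =
    +-cancelˡ-≡ (edgeSum (wt w) (PendantSubrel.rel forest)) _ _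
      (trans (sym (weight-extendPattern linked linked-adj es₁ pat₁ w))
      (trans (constant _ _ (extendPattern-isStarFactor linked linked-adj es₁ pat₁)
                           (extendPattern-isStarFactor linked linked-adj es₂ pat₂))
             (weight-extendPattern linked linked-adj es₂ pat₂ w)))

-- Cycles through an outside vertex

-- A cycle is encoded by a list over Maybe (Fin L): nothing is an outside vertex adjacent to
-- vertex a and vertex b, and just i is vertex i.
distinctᵇ : ∀ {L} → Maybe (Fin L) → Maybe (Fin L) → Bool
distinctᵇ nothing  nothing  = false
distinctᵇ nothing  (just _) = true
distinctᵇ (just _) nothing  = true
distinctᵇ (just i) (just j) = not (i ≡ᵇ j)

module _ {L : ℕ} (linked : Fin L → Bool) (a b : Fin L) where

  adjacentᵇ : Maybe (Fin L) → Maybe (Fin L) → Bool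
  adjacentᵇ nothing  nothing  = false
  adjacentᵇ nothing  (just j) = j ≡ᵇ a ∨ j ≡ᵇ b
  adjacentᵇ (just i) nothing  = i ≡ᵇ a ∨ i ≡ᵇ b
  adjacentᵇ (just i) (just j) = linkedPairᵇ linked i j

  cycleCodeᵇ : List (Maybe (Fin L)) → Bool
  cycleCodeᵇ cs = (3 ≤ᵇ length cs) ∧ (injectiveCodeᵇ cs ∧ adjacentCodeᵇ cs)
    where
    injectiveCodeᵇ adjacentCodeᵇ : List (Maybe (Fin L)) → Bool
    injectiveCodeᵇ cs = allᵇ λ x → allᵇ λ y → x ≡ᵇ y ∨ distinctᵇ (lookup cs x) (lookup cs y)
    adjacentCodeᵇ  cs = allᵇ λ x → adjacentᵇ (lookup cs x) (lookup cs (next x))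

module _ {G : Graph} {L : ℕ} (E : Embedding G L) {linked : Fin L → Bool} (linked-adj : Linked E linked)
         {u : Fin (n G)} (u-out : outside E u ≡ true) {a b : Fin L}
         (ua : adj G u (Embedding.vertex E a) ≡ true) (ub : adj G u (Embedding.vertex E b) ≡ true) where
  open Embedding E
  private
    decode : Maybe (Fin L) → Fin (n G)
    decode nothing  = u
    decode (just i) = vertex i

    adj-sym : ∀ {x y} → adj G x y ≡ true → adj G y x ≡ true
    adj-sym {x} {y} e = trans (Graph.sym G y x) e

    to-a-or-b : ∀ i → i ≡ᵇ a ∨ i ≡ᵇ b ≡ true → adj G u (vertex i) ≡ true
    to-a-or-b i e with ∨-elim {i ≡ᵇ a} e
    ... | inj₁ i≡a = subst (λ k → adj G u (vertex k) ≡ true) (sym (≡ᵇ⇒≡ i≡a)) ua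
    ... | inj₂ i≡b = subst (λ k → adj G u (vertex k) ≡ true) (sym (≡ᵇ⇒≡ i≡b)) ub

    adjacent-sound : ∀ c d → adjacentᵇ linked a b c d ≡ true → adj G (decode c) (decode d) ≡ true
    adjacent-sound nothing  (just j) e = to-a-or-b j e
    adjacent-sound (just i) nothing  e = adj-sym (to-a-or-b i e)
    adjacent-sound (just i) (just j) e = linkedPair-adj E linked-adj i j e

    distinct-sound : ∀ c d → distinctᵇ c d ≡ true → decode c ≢ decode d
    distinct-sound nothing  (just j) _ e = outside⇒≢vertex E u-out j (sym e)
    distinct-sound (just i) nothing  _ e = outside⇒≢vertex E u-out i e
    distinct-sound (just i) (just j) d e = ≡ᵇ-false⇒≢ (not-elim d) (injective e)

  cycleCode-sound : ∀ cs → cycleCodeᵇ linked a b cs ≡ true → HasCycle G (length cs)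
  cycleCode-sound cs ok = ≤ᵇ⇒≤ 3 (length cs) (subst T (sym length-ok) tt) , decode ∘ lookup cs , inj , adjacent
    where
    length-ok = proj₁ (∧-elim ok)
    rest = proj₂ (∧-elim {3 ≤ᵇ length cs} ok)

    inj : Injective _≡_ _≡_ (decode ∘ lookup cs)
    inj {x} {y} e with ∨-elim (allᵇ₂-sound _ (proj₁ (∧-elim rest)) x y)
    ... | inj₁ x≡y = ≡ᵇ⇒≡ x≡y
    ... | inj₂ x≢y = ⊥-elim (distinct-sound (lookup cs x) (lookup cs y) x≢y e)

    adjacent : ∀ x → adj G (decode (lookup cs x)) (decode (lookup cs (next x))) ≡ true
    adjacent x = adjacent-sound (lookup cs x) (lookup cs (next x)) (allᵇ-sound _ adjacent-ok x)
      where adjacent-ok = proj₂ (∧-elim {allᵇ λ x → allᵇ λ y → x ≡ᵇ y ∨ distinctᵇ (lookup cs x) (lookup cs y)} rest)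

∑-mono-≤ : ∀ {m} (f g : Fin m → ℕ) → (∀ i → f i ≤ g i) → ∑ f ≤ ∑ g
∑-mono-≤ {zero}  f g f≤g = z≤n
∑-mono-≤ {suc m} f g f≤g = +-mono-≤ (f≤g zero) (∑-mono-≤ (f ∘ suc) (g ∘ suc) (f≤g ∘ suc))

module _ (G : Graph) (v : Fin (n G)) where
  private
    indicator : Fin (n G) → ℕ
    indicator u = if adj G v u then 1 else 0

  deg-isolated : (∀ u → adj G v u ≡ false) → deg G v ≡ 0
  deg-isolated no-nbr = trans (sum-allFin indicator) (∑-zero indicator λ u → cong (λ b → if b then 1 else 0) (no-nbr u))

  deg-pendant : ∀ x → PendantAt (adj G) v x → deg G v ≤ 1
  deg-pendant x leaf = subst (_≤ 1) (sym (sum-allFin indicator))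
    (subst (∑ indicator ≤_) (∑-indicator x 1) (∑-mono-≤ indicator _ at-most-x))
    where
    at-most-x : ∀ u → indicator u ≤ (if u ≡ᵇ x then 1 else 0)
    at-most-x u with adj G v u in vu
    ... | false = z≤n
    ... | true rewrite leaf u vu | ≡ᵇ-refl x = ≤-refl

  two-neighbours : 2 ≤ deg G v → ∃ λ x₁ → ∃ λ x₂ → x₁ ≢ x₂ × adj G v x₁ ≡ true × adj G v x₂ ≡ true
  two-neighbours 2≤deg with anyᵇ (adj G v) in some
  ... | false = ⊥-elim (2≰0 (subst (2 ≤_) (deg-isolated (anyᵇ-false (adj G v) some)) 2≤deg))
    where
    2≰0 : ¬ 2 ≤ 0
    2≰0 ()
  ... | true with anyᵇ-sound (adj G v) some
  ...   | x₁ , vx₁ with hasOtherNbr (adj G) v x₁ in other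
  ...     | true with hasOtherNbr-sound (adj G) v x₁ other
  ...       | x₂ , x₂≢x₁ , vx₂ = x₁ , x₂ , (x₂≢x₁ ∘ sym) , vx₁ , vx₂
  two-neighbours 2≤deg | true | x₁ , vx₁ | false =
    ⊥-elim (2≰1 (≤-trans 2≤deg (deg-pendant x₁ (hasOtherNbr-false (adj G) v x₁ other))))
    where
    2≰1 : ¬ 2 ≤ 1
    2≰1 (s≤s ())

closeWalk : ∀ {L} → List (Fin L) → List (Maybe (Fin L))
closeWalk w = nothing ∷ map just w

shortCycleᵇ : ∀ {L} → (Fin L → Bool) → (Fin L → Fin L → List (Fin L)) → (ℕ → Bool) → Fin L → Fin L → Bool
shortCycleᵇ linked walk accept a b = cycleCodeᵇ linked a b (closeWalk (walk a b)) ∧ accept (length (closeWalk (walk a b)))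

module _ {G : Graph} (δ≥2 : MinDegGe G 2) {L : ℕ} (E : Embedding G L)
         {linked : Fin L → Bool} (linked-adj : Linked E linked) where
  open Embedding E

  private
    outside-or-two-on : ∀ v → (∃ λ u → adj G v u ≡ true × outside E u ≡ true) ⊎
      (∃ λ a → ∃ λ b → a ≢ b × adj G v (vertex a) ≡ true × adj G v (vertex b) ≡ true)
    outside-or-two-on v with any? (λ u → adj G v u ∧ outside E u ≟ᴮ true)
    ... | yes (u , e) = inj₁ (u , ∧-elim e)
    ... | no none with two-neighbours G v (δ≥2 v)
    ...   | x₁ , x₂ , x₁≢x₂ , vx₁ , vx₂ with inside⇒vertex E x₁ (inside vx₁) | inside⇒vertex E x₂ (inside vx₂)
      where
      inside : ∀ {x} → adj G v x ≡ true → outside E x ≡ false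
      inside {x} vx with outside E x in out
      ... | false = refl
      ... | true  = ⊥-elim (none (x , ∧-intro vx out))
    ...     | a , refl | b , refl = inj₂ (a , b , (λ { refl → x₁≢x₂ refl }) , vx₁ , vx₂)

  no-isolated-outside : (walk : Fin L → Fin L → List (Fin L)) (accept : ℕ → Bool) →
    (∀ k → accept k ≡ true → ¬ HasCycle G k) →
    allᵇ (λ a → allᵇ λ b → a ≡ᵇ b ∨ shortCycleᵇ linked walk accept a b) ≡ true →
    NoIsolatedOutside E
  no-isolated-outside walk accept no-cycle checked v out with outside-or-two-on v
  ... | inj₁ nbr = nbr
  ... | inj₂ (a , b , a≢b , va , vb) with ∨-elim (allᵇ₂-sound _ checked a b)
  ...   | inj₁ a≡b = ⊥-elim (a≢b (≡ᵇ⇒≡ a≡b))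
  ...   | inj₂ short with ∧-elim {cycleCodeᵇ linked a b (closeWalk (walk a b))} short
  ...     | code-ok , accepted =
    ⊥-elim (no-cycle _ accepted (cycleCode-sound E linked-adj out va vb (closeWalk (walk a b)) code-ok))

-- Unbalanced configurations

cycleLinked : ∀ {L} → Fin L → Bool
cycleLinked _ = true

pathLinked : ∀ {L} → Fin (suc L) → Bool
pathLinked {L} i = toℕ i <ᵇ L

edgesAt : ∀ {L} → List (Fin L) → Pattern L
edgesAt = map λ i → i , next i

patternSum-cancel : ∀ {L} (c : Fin L → Fin L → ℕ) (common xs ys : List (Fin L)) →
  patternSum c (edgesAt (common ++ xs)) ≡ patternSum c (edgesAt (common ++ ys)) →
  patternSum c (edgesAt xs) ≡ patternSum c (edgesAt ys)
patternSum-cancel c []           xs ys eq = eq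
patternSum-cancel c (i ∷ common) xs ys eq = patternSum-cancel c common xs ys (+-cancelˡ-≡ (c i (next i)) _ _ eq)

module Balance {G : Graph} (w : EdgeWeighting G) (constant : ConstantOnStarFactors G w)
               {L : ℕ} (E : Embedding G L) (no-isolated : NoIsolatedOutside E)
               {linked : Fin L → Bool} (linked-adj : Linked E linked) where
  open Embedding E

  e : Fin L → ℕ
  e i = wt w (vertex i) (vertex (next i))

  e-positive : ∀ i → linked i ≡ true → 1 ≤ e i
  e-positive i li = wtPos w _ _ (linked-adj i li)

  balance : ∀ common xs ys →
    isStarPatternᵇ linked (edgesAt (common ++ xs)) ≡ true → isStarPatternᵇ linked (edgesAt (common ++ ys)) ≡ true →
    patternSum (λ i j → wt w (vertex i) (vertex j)) (edgesAt xs) ≡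
    patternSum (λ i j → wt w (vertex i) (vertex j)) (edgesAt ys)
  balance common xs ys ok₁ ok₂ = patternSum-cancel _ common xs ys
    (patternSum-constant E no-isolated w constant linked linked-adj (edgesAt (common ++ xs)) (edgesAt (common ++ ys))
       (starPattern-sound linked _ ok₁) (starPattern-sound linked _ ok₂))

shifted-sums-absurd : ∀ {x y z} → 1 ≤ z → x + 0 ≡ y + 0 → x + 0 ≡ z + (y + 0) → ⊥
shifted-sums-absurd {x} {y} {suc z} _ h₁ h₂ = m≢1+n+m (y + 0) {z} (trans (sym h₁) h₂)

module _ {G : Graph} (w : EdgeWeighting G) (constant : ConstantOnStarFactors G w) where

  -- writing eᵢ for the weight of the edge i, i + 1: e₂ = e₁ + e₃ and e₃ = e₂ + e₄
  cycle₆-unbalanced : (E : Embedding G 6) → NoIsolatedOutside E → Linked E cycleLinked → ⊥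
  cycle₆-unbalanced E no-isolated linked-adj =
    cycle-sums-absurd (e-positive (# 1) refl)
      (sym (balance (# 0 ∷ # 4 ∷ []) (# 2 ∷ []) (# 1 ∷ # 3 ∷ []) refl refl))
      (balance (# 1 ∷ # 5 ∷ []) (# 2 ∷ # 4 ∷ []) (# 3 ∷ []) refl refl)
    where
    open Balance w constant E no-isolated linked-adj
    cycle-sums-absurd : ∀ {a b c d} → 1 ≤ a → a + (b + 0) ≡ c + 0 → c + (d + 0) ≡ b + 0 → ⊥
    cycle-sums-absurd {suc a} {b} {c} {d} _ h₁ h₂ = m≢1+n+m b (begin
      b                          ≡⟨ sym (+-identityʳ b) ⟩
      b + 0                      ≡⟨ sym h₂ ⟩
      c + (d + 0)                ≡⟨ cong (_+ (d + 0)) (trans (sym (+-identityʳ c)) (sym h₁)) ⟩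
      suc a + (b + 0) + (d + 0)  ≡⟨ rearrange a b d ⟩
      suc (a + d + b)            ∎)
      where
      open ≡-Reasoning
      rearrange : ∀ a b d → suc a + (b + 0) + (d + 0) ≡ suc (a + d + b)
      rearrange = solve-∀

  -- e₄ = e₅ and e₄ = e₃ + e₅
  path₈-unbalanced : (E : Embedding G 8) → NoIsolatedOutside E → Linked E pathLinked → ⊥
  path₈-unbalanced E no-isolated linked-adj =
    shifted-sums-absurd (e-positive (# 3) refl)
      (balance (# 0 ∷ # 1 ∷ # 3 ∷ # 6 ∷ []) (# 4 ∷ []) (# 5 ∷ []) refl refl)
      (balance (# 0 ∷ # 2 ∷ # 6 ∷ []) (# 4 ∷ []) (# 3 ∷ # 5 ∷ []) refl refl)
    where open Balance w constant E no-isolated linked-adj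

  -- e₅ = e₆ and e₅ = e₄ + e₆
  path₉-unbalanced : (E : Embedding G 9) → NoIsolatedOutside E → Linked E pathLinked → ⊥
  path₉-unbalanced E no-isolated linked-adj =
    shifted-sums-absurd (e-positive (# 4) refl)
      (balance (# 0 ∷ # 2 ∷ # 4 ∷ # 7 ∷ []) (# 5 ∷ []) (# 6 ∷ []) refl refl)
      (balance (# 0 ∷ # 1 ∷ # 3 ∷ # 7 ∷ []) (# 5 ∷ []) (# 4 ∷ # 6 ∷ []) refl refl)
    where open Balance w constant E no-isolated linked-adj

-- Girth and long paths

walkTo : ∀ {L} → ℕ → Fin L → Fin L → List (Fin L)
walkTo zero    a b = a ∷ []
walkTo (suc k) a b = a ∷ (if a ≡ᵇ b then [] else walkTo k (next a) b)

cycleWalk : ∀ {L} → Fin L → Fin L → List (Fin L)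
cycleWalk {L} a b = if length (walkTo L a b) ≤ᵇ length (walkTo L b a) then walkTo L a b else walkTo L b a

pathWalk : ∀ {L} → Fin L → Fin L → List (Fin L)
pathWalk {L} a b = if toℕ a <ᵇ toℕ b then walkTo L a b else walkTo L b a

cycleEmbedding : {G : Graph} {k : ℕ} → HasCycle G k → Σ (Embedding G k) λ E → Linked E cycleLinked
cycleEmbedding (_ , f , f-injective , f-adj) = record { vertex = f ; injective = f-injective } , λ i _ → f-adj i

module _ {G : Graph} (δ≥2 : MinDegGe G 2) (w : EdgeWeighting G) (constant : ConstantOnStarFactors G w) where

  no-6-cycle : GirthGe G 6 → ¬ HasCycle G 6
  no-6-cycle girth C with cycleEmbedding C
  ... | E , linked-adj = cycle₆-unbalanced w constant E
    (no-isolated-outside δ≥2 E linked-adj cycleWalk (_<ᵇ 6) (λ k k<6 → girth k (<ᵇ-sound k<6)) refl) linked-adj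

  private
    path-of-cycle : ∀ {L} {E : Embedding G (suc L)} → Linked E cycleLinked → Linked E pathLinked
    path-of-cycle linked-adj i _ = linked-adj i refl

  no-8-cycle : GirthGe G 8 → ¬ HasCycle G 8
  no-8-cycle girth C with cycleEmbedding C
  ... | E , linked-adj = path₈-unbalanced w constant E
    (no-isolated-outside δ≥2 E linked-adj cycleWalk (_<ᵇ 8) (λ k k<8 → girth k (<ᵇ-sound k<8)) refl)
    (path-of-cycle {E = E} linked-adj)

  no-9-cycle : GirthGe G 8 → ¬ HasCycle G 9
  no-9-cycle girth C with cycleEmbedding C
  ... | E , linked-adj = path₉-unbalanced w constant E
    (no-isolated-outside δ≥2 E linked-adj cycleWalk (_<ᵇ 8) (λ k k<8 → girth k (<ᵇ-sound k<8)) refl)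
    (path-of-cycle {E = E} linked-adj)

  -- an outside vertex joined to two vertices of the path closes a cycle of length at most 9
  no-8-path : GirthGe G 8 → (E : Embedding G 8) → ¬ Linked E pathLinked
  no-8-path girth E linked-adj = path₈-unbalanced w constant E
    (no-isolated-outside δ≥2 E linked-adj pathWalk (_<ᵇ 10) (λ k k<10 → below-10 k (<ᵇ-sound k<10)) refl) linked-adj
    where
    below-10 : ∀ k → k < 10 → ¬ HasCycle G k
    below-10 k k<10 with m≤n⇒m<n∨m≡n (≤-pred k<10)
    ... | inj₂ refl = no-9-cycle girth
    ... | inj₁ k<9 with m≤n⇒m<n∨m≡n (≤-pred k<9)
    ...   | inj₂ refl = no-8-cycle girth
    ...   | inj₁ k<8  = girth k k<8

toℕ-next : ∀ {k} (i : Fin (suc k)) → toℕ i < k → toℕ (next i) ≡ suc (toℕ i)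
toℕ-next {k} i i<k = trans (toℕ-fromℕ< (m%n<n (suc (toℕ i)) (suc k))) (m<n⇒m%n≡m (s≤s i<k))

next-last : ∀ {k} (i : Fin (suc k)) → toℕ i ≡ k → next i ≡ zero
next-last {k} i i≡k = toℕ-injective (trans (toℕ-fromℕ< (m%n<n (suc (toℕ i)) (suc k)))
                                           (trans (cong (λ x → suc x % suc k) i≡k) (n%n≡0 (suc k))))

module _ (G : Graph) where
  private V = Fin (n G)

  -- paths grow at y zero
  record Path (k : ℕ) : Set where
    field
      y           : Fin (suc k) → V
      injective   : Injective _≡_ _≡_ y
      consecutive : ∀ i j → toℕ j ≡ suc (toℕ i) → adj G (y i) (y j) ≡ true

  private
    trivialPath : V → Path 0
    trivialPath v = record
      { y = λ _ → v ; injective = λ { {zero} {zero} _ → refl } ; consecutive = λ { zero zero () } }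

    extend : ∀ {k} (P : Path k) (h : V) → adj G h (Path.y P zero) ≡ true → (∀ i → Path.y P i ≢ h) → Path (suc k)
    extend {k} P h h-adj h-new = record { y = y′ ; injective = injective′ ; consecutive = consecutive′ }
      where
      open Path P
      y′ : Fin (suc (suc k)) → V
      y′ zero    = h
      y′ (suc i) = y i
      injective′ : Injective _≡_ _≡_ y′
      injective′ {zero}  {zero}  _ = refl
      injective′ {zero}  {suc j} e = ⊥-elim (h-new j (sym e))
      injective′ {suc i} {zero}  e = ⊥-elim (h-new i e)
      injective′ {suc i} {suc j} e = cong suc (injective e)
      consecutive′ : ∀ i j → toℕ j ≡ suc (toℕ i) → adj G (y′ i) (y′ j) ≡ true
      consecutive′ zero    (suc zero)    _ = h-adj
      consecutive′ zero    (suc (suc j)) ()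
      consecutive′ (suc i) (suc j)       e = consecutive i j (cong pred e)

  MaximalPath : Set
  MaximalPath = Σ ℕ λ k → Σ (Path k) λ P → ∀ h → adj G (Path.y P zero) h ≡ true → ∃ λ i → Path.y P i ≡ h

  -- the fuel suffices because an injective path has at most n G vertices
  maximalPath : ∀ fuel {k} → n G ≤ suc k + fuel → Path k → MaximalPath
  maximalPath fuel {k} bound P
    with any? (λ h → (adj G (Path.y P zero) h ≟ᴮ true) ×-dec ¬? (any? (λ i → Path.y P i ≟ h)))
  ... | no none = k , P , λ h adj-h → decidable-stable (any? (λ i → Path.y P i ≟ h)) (λ h∉ → none (h , adj-h , h∉))
  ... | yes (h , adj-h , h∉) with extend P h (trans (Graph.sym G h _) adj-h) (λ i e → h∉ (i , e)) | fuel
  ...   | P′ | zero     = ⊥-elim (1+n≰n (≤-trans (injective⇒≤ (Path.injective P′))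
                                              (subst (n G ≤_) (+-identityʳ (suc k)) bound)))
  ...   | P′ | suc fuel = maximalPath fuel (subst (n G ≤_) (+-suc (suc k) fuel) bound) P′

  module _ {k : ℕ} (P : Path k) where
    open Path P

    prefix : ∀ {m} → m ≤ k → Path m
    prefix m≤k = record
      { y = y ∘ embed
      ; injective = λ {i} {j} e →
          toℕ-injective (trans (sym (toℕ-inject≤ i _)) (trans (cong toℕ (injective e)) (toℕ-inject≤ j _)))
      ; consecutive = λ i j e →
          consecutive (embed i) (embed j) (trans (toℕ-inject≤ j _) (trans e (cong suc (sym (toℕ-inject≤ i _))))) }
      where
      embed : Fin _ → Fin (suc k)
      embed i = inject≤ i (s≤s m≤k)

    pathEmbedding : Σ (Embedding G (suc k)) λ E → Linked E pathLinked
    pathEmbedding = record { vertex = y ; injective = injective } ,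
                    λ i i<k → consecutive i (next i) (toℕ-next i (<ᵇ-sound i<k))

    closePath : 2 ≤ k → (∀ i → toℕ i ≡ k → adj G (y i) (y zero) ≡ true) → HasCycle G (suc k)
    closePath 2≤k last-adj = s≤s 2≤k , y , injective , around
      where
      around : ∀ i → adj G (y i) (y (next i)) ≡ true
      around i with m≤n⇒m<n∨m≡n (≤-pred (toℕ<n i))
      ... | inj₁ i<k = consecutive i (next i) (toℕ-next i i<k)
      ... | inj₂ i≡k rewrite next-last i i≡k = last-adj i i≡k

    far-neighbour : (∀ h → adj G (y zero) h ≡ true → ∃ λ i → y i ≡ h) → 2 ≤ deg G (y zero) →
                    ∃ λ t → 2 ≤ toℕ t × adj G (y zero) (y t) ≡ true
    far-neighbour maximal 2≤deg with two-neighbours G (y zero) 2≤deg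
    ... | x₁ , x₂ , x₁≢x₂ , adj₁ , adj₂ with maximal x₁ adj₁ | maximal x₂ adj₂
    ...   | a , refl | b , refl = pick a b (λ a≡b → x₁≢x₂ (cong y a≡b)) adj₁ adj₂
      where
      not-zero : ∀ {i} → adj G (y zero) (y i) ≡ true → i ≢ zero
      not-zero {i} e refl with trans (sym e) (loopless G (y zero))
      ... | ()
      pick : ∀ a b → a ≢ b → adj G (y zero) (y a) ≡ true → adj G (y zero) (y b) ≡ true →
             ∃ λ t → 2 ≤ toℕ t × adj G (y zero) (y t) ≡ true
      pick zero             _                   _   ea _  = ⊥-elim (not-zero ea refl)
      pick (suc _)          zero                _   _  eb = ⊥-elim (not-zero eb refl)
      pick (suc zero)       (suc zero)          a≢b _  _  = ⊥-elim (a≢b refl)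
      pick (suc zero)       (suc (suc b))       _   _  eb = suc (suc b) , s≤s (s≤s z≤n) , eb
      pick (suc (suc a))    _                   _   ea _  = suc (suc a) , s≤s (s≤s z≤n) , ea

  path-on-8-vertices : NonZero (n G) → MinDegGe G 2 → GirthGe G 8 → Σ (Embedding G 8) λ E → Linked E pathLinked
  path-on-8-vertices nonZero δ≥2 girth
    with maximalPath (n G) (n≤1+n (n G)) (trivialPath (fromℕ< (>-nonZero⁻¹ (n G) {{nonZero}})))
  ... | k , P , maximal with far-neighbour P maximal (δ≥2 _)
  ...   | t , 2≤t , adj-t with 8 ≤? suc (toℕ t)
  ...     | no t<7 = ⊥-elim (girth _ (≰⇒> t<7) (closePath (prefix P t≤k) 2≤t closing))
    where
    t≤k = ≤-pred (toℕ<n t)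
    closing : ∀ i → toℕ i ≡ toℕ t → adj G (Path.y (prefix P t≤k) i) (Path.y P zero) ≡ true
    closing i i≡t rewrite toℕ-injective {i = inject≤ i (s≤s t≤k)} {j = t} (trans (toℕ-inject≤ i _) i≡t) =
      trans (Graph.sym G _ _) adj-t
  ...     | yes 7≤t = pathEmbedding (prefix P (≤-trans (≤-pred 7≤t) (≤-pred (toℕ<n t))))


theorem2p1 : (G : Graph) → NonZero (n G) → MinDegGe G 2 →
    (GirthEq G 6 ⊎ GirthGe G 8) → ¬ InΩ G
theorem2p1 G nonZero δ≥2 (inj₁ (C₆ , girth≥6)) (w , constant) = no-6-cycle δ≥2 w constant girth≥6 C₆
theorem2p1 G nonZero δ≥2 (inj₂ girth≥8) (w , constant) with path-on-8-vertices G nonZero δ≥2 girth≥8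
... | E , linked-adj = no-8-path δ≥2 w constant girth≥8 E linked-adj
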